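{- Let $G$ be a connected graph and $C\subseteq G$ a cycle. The inequality $\sum_{e\in E(C)}x_e\le 2$ is valid for $\textsc{Bond}(G)$ if and only if $C$ is non-interleaved.
   Context: For a graph $G=(V,E)$ and $S\subseteq V$, the cut $\delta(S)=\{e\in E:|e\cap S|=1\}$ is a bond if $G[S]$ and $G[V\setminus S]$ are connected. $x^\delta$ is the incidence vector, $\textsc{Bond}(G)=\mathrm{conv}\{x^\delta:\delta\text{ a bond}\}$. A cycle $C\subseteq G$ is interleaved if there are vertices $v_1,v_2,v_3,v_4\in V(C)$ occurring along $C$ in this order and vertex-disjoint paths in $G-E(C)$ connecting $v_1$ with $v_3$ and $v_2$ with $v_4$, respectively; otherwise it is non-interleaved.
   Formalization: The polytope $\textsc{Bond}(G)$ is taken over the rationals: its points have rational coordinates and the convex combinations of bond incidence vectors use rational coefficients. -}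

module Defs where

open import Data.Nat using (ℕ; zero; suc; _<_; _≥_)
open import Data.Nat.DivMod using (_%_; m%n<n)
open import Data.Fin using (Fin; toℕ; fromℕ<)
open import Data.Bool using (Bool; true; false; _xor_; if_then_else_)
open import Data.Product using (Σ; ∃; ∃-syntax; _×_; _,_; proj₁; proj₂)
open import Data.Sum using (_⊎_)
open import Data.Unit using (⊤)
open import Data.Empty using (⊥)
open import Data.List using (List; []; _∷_)
open import Data.List.Membership.Propositional using (_∈_)
open import Data.List.Relation.Unary.Unique.Propositional using (Unique)
open import Data.Integer using (+_)
open import Data.Rational using (ℚ; 0ℚ; 1ℚ; _/_; _+_; _*_; _≤_)
open import Relation.Binary.PropositionalEquality using (_≡_)
open import Relation.Nullary using (¬_)
open import Function.Definitions using (Injective)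

record Graph (n m : ℕ) : Set where
  field
    ends      : Fin m → Fin n × Fin n
    loopless  : ∀ e → ¬ (proj₁ (ends e) ≡ proj₂ (ends e))
    simple    : ∀ e f →
                  (proj₁ (ends e) ≡ proj₁ (ends f) × proj₂ (ends e) ≡ proj₂ (ends f))
                  ⊎ (proj₁ (ends e) ≡ proj₂ (ends f) × proj₂ (ends e) ≡ proj₁ (ends f))
                  → e ≡ f
open Graph public

module _ {n m : ℕ} (G : Graph n m) where

  Joins : Fin m → Fin n → Fin n → Set
  Joins e u v = (proj₁ (ends G e) ≡ u × proj₂ (ends G e) ≡ v)
              ⊎ (proj₁ (ends G e) ≡ v × proj₂ (ends G e) ≡ u)

  data Walk (allowed : Fin m → Set) : Fin n → Fin n → List (Fin n) → Set where
    here : ∀ {u} → Walk allowed u u (u ∷ [])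
    step : ∀ {u v w vs} (e : Fin m) → allowed e → Joins e u v →
           Walk allowed v w vs → Walk allowed u w (u ∷ vs)

  Path : (Fin m → Set) → Fin n → Fin n → List (Fin n) → Set
  Path allowed u v vs = Walk allowed u v vs × Unique vs

  Connected : Set
  Connected = ∀ u v → ∃[ vs ] Path (λ _ → ⊤) u v vs

  InS : (Fin n → Bool) → Fin n → Set
  InS S v = S v ≡ true

  InducedEdge : (Fin n → Bool) → Fin m → Set
  InducedEdge S e = InS S (proj₁ (ends G e)) × InS S (proj₂ (ends G e))

  InducedConnected : (Fin n → Bool) → Set
  InducedConnected S = ∀ u v → InS S u → InS S v →
                       ∃[ vs ] Path (InducedEdge S) u v vs

  complement : (Fin n → Bool) → Fin n → Bool
  complement S v = if S v then false else true

  -- δ(S) is a bond: S, V∖S nonempty and G[S], G[V∖S] connected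
  IsBond : (Fin n → Bool) → Set
  IsBond S = (∃[ v ] InS S v) × (∃[ v ] InS (complement S) v)
           × InducedConnected S × InducedConnected (complement S)

  cutVector : (Fin n → Bool) → Fin m → ℚ
  cutVector S e = if S (proj₁ (ends G e)) xor S (proj₂ (ends G e)) then 1ℚ else 0ℚ

sumℚ : ∀ k → (Fin k → ℚ) → ℚ
sumℚ zero    f = 0ℚ
sumℚ (suc k) f = f Fin.zero + sumℚ k (λ i → f (Fin.suc i))

2ℚ : ℚ
2ℚ = + 2 / 1

module _ {n m : ℕ} (G : Graph n m) where

  InBondPolytope : (Fin m → ℚ) → Set
  InBondPolytope x =
    ∃[ k ] Σ (Fin k → ℚ) λ c → Σ (Fin k → (Fin n → Bool)) λ S →
      (∀ i → IsBond G (S i)) × (∀ i → 0ℚ ≤ c i) × sumℚ k c ≡ 1ℚ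
      × (∀ e → x e ≡ sumℚ k (λ i → c i * cutVector G (S i) e))

csuc : ∀ {k} → Fin (suc k) → Fin (suc k)
csuc {k} i = fromℕ< (m%n<n (suc (toℕ i)) (suc k))

record Cycle {n m : ℕ} (G : Graph n m) : Set where
  field
    len-1   : ℕ
    len≥3   : suc len-1 ≥ 3
    vert    : Fin (suc len-1) → Fin n
    vertInj : Injective _≡_ _≡_ vert
    edge    : Fin (suc len-1) → Fin m
    edgeJ   : ∀ i → Joins G (edge i) (vert i) (vert (csuc i))
open Cycle public

module _ {n m : ℕ} {G : Graph n m} (C : Cycle G) where

  InCycle : Fin m → Set
  InCycle e = ∃[ i ] edge C i ≡ e

  NotInCycle : Fin m → Set
  NotInCycle e = ¬ InCycle e

  Disjoint : List (Fin n) → List (Fin n) → Set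
  Disjoint xs ys = ∀ v → v ∈ xs → v ∈ ys → ⊥

  Interleaved : Set
  Interleaved =
    Σ (Fin (suc (len-1 C))) λ i₁ → Σ (Fin (suc (len-1 C))) λ i₂ →
    Σ (Fin (suc (len-1 C))) λ i₃ → Σ (Fin (suc (len-1 C))) λ i₄ →
      toℕ i₁ < toℕ i₂ × toℕ i₂ < toℕ i₃ × toℕ i₃ < toℕ i₄ ×
      Σ (List (Fin n)) λ P → Σ (List (Fin n)) λ Q →
        Path G NotInCycle (vert C i₁) (vert C i₃) P ×
        Path G NotInCycle (vert C i₂) (vert C i₄) Q ×
        Disjoint P Q

  NonInterleaved : Set
  NonInterleaved = ¬ Interleaved

  CycleIneqValid : Set
  CycleIneqValid = ∀ x → InBondPolytope G x →
                   sumℚ (suc (len-1 C)) (λ i → x (edge C i)) ≤ 2ℚ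

-- Along C the cut vector of S sums to the number of cyclic positions at which consecutive
-- cycle vertices lie on different shores of S, and this number exceeds 2 exactly when four
-- cycle vertices, in their order along C, alternate between S and V ∖ S.
--
-- If C is interleaved by disjoint paths P (v₁ to v₃) and Q (v₂ to v₄), let R₁ be the
-- vertices reachable from v₁ avoiding Q and R₂ those reachable from v₂ avoiding R₁.
-- Then S = V ∖ R₂ is a bond (G[S] is connected through R₁ since G is connected) whose
-- shores alternate on v₁, v₂, v₃, v₄, so x^δ(S) violates the inequality.
--
-- Conversely, if a bond alternates on positions a < b < c < d, walk inside the shore of a and
-- c from a to c and cut the walk at its last cycle vertex before it reaches the arc between b
-- and d: the remainder is a path of G − E(C) joining the two arcs determined by b and d.
-- Repeating this in the other shore with the ends of the first path gives a second path whose
-- ends interleave with those of the first, disjoint from it since the shores are disjoint.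

module Submission where

open import Defs
open import Algebra.Bundles using (CommutativeRing)
open import Data.Bool using (Bool; true; false; not; _xor_; if_then_else_)
open import Data.Bool.Properties using (not-involutive; not-¬; xor-same; xor-comm; xor-inverseʳ)
open import Data.Empty using (⊥-elim)
open import Data.Fin as Fin using (Fin; toℕ; fromℕ<) renaming (_≟_ to _≟ᶠ_)
open import Data.Fin.Properties using (toℕ-fromℕ<; toℕ-injective; toℕ<n; any?)
open import Data.List using (List; []; _∷_; _++_; [_])
open import Data.List.Membership.Propositional using (_∈_)
open import Data.List.Membership.Propositional.Properties using (∈-++⁻)
import Data.List.Membership.DecPropositional as DecMembership
open import Data.List.Relation.Unary.Any using (here; there)
open import Data.List.Relation.Unary.All using ([])
open import Data.List.Relation.Unary.All.Properties.Core using (¬Any⇒All¬)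
open import Data.List.Relation.Unary.AllPairs using ([]; _∷_)
open import Data.List.Relation.Unary.Unique.Propositional using (Unique)
open import Data.Nat using (ℕ; zero; suc; _+_; _≤_; _<_; z≤n; s≤s; _%_)
open import Data.Nat.DivMod using (m%n<n; m<n⇒m%n≡m; n%n≡0)
open import Data.Nat.Properties
  using (≤-refl; ≤-reflexive; ≤-trans; ≤-antisym; ≤-pred; <⇒≤; <⇒≱; ≮⇒≥; <-trans; <-asym; <-cmp; _<?_;
         +-comm; +-assoc; +-identityʳ; +-monoʳ-≤; +-monoˡ-≤; m≤m+n; suc-injective;
         m≤n⇒m<n∨m≡n; m≤n⇒m≤1+n; n≤1+n; n<1+n; module ≤-Reasoning)
open import Data.Product using (∃-syntax; _×_; _,_; proj₁; proj₂)
open import Data.Sum using (_⊎_; inj₁; inj₂)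
open import Data.Unit using (⊤; tt)
import Data.Rational as ℚ
open ℚ using (ℚ; 0ℚ; 1ℚ)
import Data.Rational.Properties as ℚ
open import Function using (_∘_; id)
open import Function.Bundles using (_⇔_; mk⇔)
open import Relation.Binary.PropositionalEquality
  using (_≡_; _≢_; refl; sym; trans; cong; cong₂; subst; module ≡-Reasoning)
open import Relation.Nullary using (¬_; yes; no; does; ¬¬-excluded-middle)
open import Relation.Nullary.Decidable using (_×-dec_; _⊎-dec_)
open import Relation.Unary using (Decidable)
open import Relation.Binary.Definitions using (tri<; tri≈; tri>)

open CommutativeRing ℚ.+-*-commutativeRing using (semiring)
open import Algebra.Properties.Semiring.Sum semiring using (sum; ∑-comm; *-distribʳ-sum; *-distribˡ-sum)

sumℚ≡sum : ∀ k (f : Fin k → ℚ) → sumℚ k f ≡ sum f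
sumℚ≡sum zero    f = refl
sumℚ≡sum (suc k) f = cong (f Fin.zero ℚ.+_) (sumℚ≡sum k (f ∘ Fin.suc))

sumℚ-cong : ∀ k {f g : Fin k → ℚ} → (∀ i → f i ≡ g i) → sumℚ k f ≡ sumℚ k g
sumℚ-cong zero    f≗g = refl
sumℚ-cong (suc k) f≗g = cong₂ ℚ._+_ (f≗g Fin.zero) (sumℚ-cong k (f≗g ∘ Fin.suc))

sumℚ-mono-≤ : ∀ k {f g : Fin k → ℚ} → (∀ i → f i ℚ.≤ g i) → sumℚ k f ℚ.≤ sumℚ k g
sumℚ-mono-≤ zero    f≤g = ℚ.≤-refl
sumℚ-mono-≤ (suc k) f≤g = ℚ.+-mono-≤ (f≤g Fin.zero) (sumℚ-mono-≤ k (f≤g ∘ Fin.suc))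

sumℚ-comm : ∀ a b (f : Fin a → Fin b → ℚ) →
            sumℚ a (λ j → sumℚ b (f j)) ≡ sumℚ b (λ i → sumℚ a (λ j → f j i))
sumℚ-comm a b f = begin
  sumℚ a (λ j → sumℚ b (f j))          ≡⟨ sumℚ-cong a (λ j → sumℚ≡sum b (f j)) ⟩
  sumℚ a (λ j → sum (f j))             ≡⟨ sumℚ≡sum a _ ⟩
  sum (λ j → sum (f j))                ≡⟨ ∑-comm f ⟩
  sum (λ i → sum (λ j → f j i))        ≡⟨ sumℚ≡sum b _ ⟨
  sumℚ b (λ i → sum (λ j → f j i))     ≡⟨ sumℚ-cong b (λ i → sumℚ≡sum a (λ j → f j i)) ⟨
  sumℚ b (λ i → sumℚ a (λ j → f j i))  ∎
  where open ≡-Reasoning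

sumℚ-*ˡ : ∀ k c (f : Fin k → ℚ) → sumℚ k (λ i → c ℚ.* f i) ≡ c ℚ.* sumℚ k f
sumℚ-*ˡ k c f = trans (sumℚ≡sum k _) (trans (sym (*-distribˡ-sum c f)) (cong (c ℚ.*_) (sym (sumℚ≡sum k f))))

sumℚ-*ʳ : ∀ k c (f : Fin k → ℚ) → sumℚ k (λ i → f i ℚ.* c) ≡ sumℚ k f ℚ.* c
sumℚ-*ʳ k c f = trans (sumℚ≡sum k _) (trans (sym (*-distribʳ-sum c f)) (cong (ℚ._* c) (sym (sumℚ≡sum k f))))

convex-combination-≤ : ∀ k (c w : Fin k → ℚ) {b} → (∀ i → 0ℚ ℚ.≤ c i) → sumℚ k c ≡ 1ℚ →
                       (∀ i → w i ℚ.≤ b) → sumℚ k (λ i → c i ℚ.* w i) ℚ.≤ b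
convex-combination-≤ k c w {b} c≥0 ∑c≡1 w≤b = begin
  sumℚ k (λ i → c i ℚ.* w i)  ≤⟨ sumℚ-mono-≤ k cw≤cb ⟩
  sumℚ k (λ i → c i ℚ.* b)    ≡⟨ sumℚ-*ʳ k b c ⟩
  sumℚ k c ℚ.* b              ≡⟨ cong (ℚ._* b) ∑c≡1 ⟩
  1ℚ ℚ.* b                    ≡⟨ ℚ.*-identityˡ b ⟩
  b                           ∎
  where
  open ℚ.≤-Reasoning
  cw≤cb : ∀ i → c i ℚ.* w i ℚ.≤ c i ℚ.* b
  cw≤cb i = ℚ.*-monoˡ-≤-nonNeg (c i) {{ℚ.nonNegative (c≥0 i)}} (w≤b i)

cutVector∈bondPolytope : ∀ {n m} (G : Graph n m) {S} → IsBond G S → InBondPolytope G (cutVector G S)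
cutVector∈bondPolytope G {S} bond =
  1 , (λ _ → 1ℚ) , (λ _ → S) , (λ _ → bond) , (λ _ → ℚ.nonNegative⁻¹ 1ℚ) , ℚ.+-identityʳ 1ℚ ,
  λ e → sym (trans (ℚ.+-identityʳ _) (ℚ.*-identityˡ _))

bondPolytope-sum-≤ : ∀ {n m} (G : Graph n m) {k} (es : Fin k → Fin m) {b} →
  (∀ S → IsBond G S → sumℚ k (λ j → cutVector G S (es j)) ℚ.≤ b) →
  ∀ x → InBondPolytope G x → sumℚ k (λ j → x (es j)) ℚ.≤ b
bondPolytope-sum-≤ G {k} es bound x (r , c , S , bonds , c≥0 , ∑c≡1 , x≡) =
  subst (ℚ._≤ _) (sym x-sum) (convex-combination-≤ r c W c≥0 ∑c≡1 (λ i → bound (S i) (bonds i)))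
  where
  W : Fin r → ℚ
  W i = sumℚ k (λ j → cutVector G (S i) (es j))
  x-sum : sumℚ k (λ j → x (es j)) ≡ sumℚ r (λ i → c i ℚ.* W i)
  x-sum = begin
    sumℚ k (λ j → x (es j))
      ≡⟨ sumℚ-cong k (x≡ ∘ es) ⟩
    sumℚ k (λ j → sumℚ r (λ i → c i ℚ.* cutVector G (S i) (es j)))
      ≡⟨ sumℚ-comm k r _ ⟩
    sumℚ r (λ i → sumℚ k (λ j → c i ℚ.* cutVector G (S i) (es j)))
      ≡⟨ sumℚ-cong r (λ i → sumℚ-*ˡ k (c i) _) ⟩
    sumℚ r (λ i → c i ℚ.* W i)
      ∎
    where open ≡-Reasoning

bit : Bool → ℕ
bit true  = 1
bit false = 0

count : ℕ → (ℕ → Bool) → ℕ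
count zero    g = 0
count (suc k) g = bit (g 0) + count k (g ∘ suc)

count-suc : ∀ k g → count (suc k) g ≡ count k g + bit (g k)
count-suc zero    g = +-comm (bit (g 0)) 0
count-suc (suc k) g = trans (cong (bit (g 0) +_) (count-suc k (g ∘ suc))) (sym (+-assoc (bit (g 0)) _ _))

fromℕ : ℕ → ℚ
fromℕ zero    = 0ℚ
fromℕ (suc k) = 1ℚ ℚ.+ fromℕ k

fromℕ-nonNeg : ∀ k → 0ℚ ℚ.≤ fromℕ k
fromℕ-nonNeg zero    = ℚ.≤-refl
fromℕ-nonNeg (suc k) = ℚ.+-mono-≤ (ℚ.nonNegative⁻¹ 1ℚ) (fromℕ-nonNeg k)

fromℕ-mono-≤ : ∀ {a b} → a ≤ b → fromℕ a ℚ.≤ fromℕ b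
fromℕ-mono-≤ {zero} {b} z≤n       = fromℕ-nonNeg b
fromℕ-mono-≤            (s≤s a≤b) = ℚ.+-monoʳ-≤ 1ℚ (fromℕ-mono-≤ a≤b)

fromℕ≤2ℚ⇒≤2 : ∀ k → fromℕ k ℚ.≤ 2ℚ → k ≤ 2
fromℕ≤2ℚ⇒≤2 0 _ = z≤n
fromℕ≤2ℚ⇒≤2 1 _ = s≤s z≤n
fromℕ≤2ℚ⇒≤2 2 _ = s≤s (s≤s z≤n)
fromℕ≤2ℚ⇒≤2 (suc (suc (suc k))) k+3≤2 =
  ⊥-elim (3≰2 (ℚ.≤-trans (fromℕ-mono-≤ {3} {3 + k} (s≤s (s≤s (s≤s z≤n)))) k+3≤2))
  where
  3≰2 : ¬ fromℕ 3 ℚ.≤ 2ℚ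
  3≰2 3≤2 with ℚ.≤⇒≤ᵇ 3≤2
  ... | ()

bitℚ : Bool → ℚ
bitℚ b = if b then 1ℚ else 0ℚ

sumℚ-bitℚ : ∀ k (g : ℕ → Bool) → sumℚ k (λ j → bitℚ (g (toℕ j))) ≡ fromℕ (count k g)
sumℚ-bitℚ zero    g = refl
sumℚ-bitℚ (suc k) g = trans (cong (bitℚ (g 0) ℚ.+_) (sumℚ-bitℚ k (g ∘ suc))) (add-bit (g 0))
  where
  add-bit : ∀ b → bitℚ b ℚ.+ fromℕ (count k (g ∘ suc)) ≡ fromℕ (bit b + count k (g ∘ suc))
  add-bit true  = refl
  add-bit false = ℚ.+-identityˡ _

changes : (ℕ → Bool) → ℕ → ℕ
changes f t = count t (λ i → f i xor f (suc i))

changes-suc : ∀ f t → changes f (suc t) ≡ changes f t + bit (f t xor f (suc t))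
changes-suc f t = count-suc t (λ i → f i xor f (suc i))

bit-xor-triangle : ∀ x y z → bit (x xor z) ≤ bit (x xor y) + bit (y xor z)
bit-xor-triangle true  true  true  = z≤n
bit-xor-triangle true  true  false = s≤s z≤n
bit-xor-triangle true  false true  = z≤n
bit-xor-triangle true  false false = s≤s z≤n
bit-xor-triangle false true  true  = s≤s z≤n
bit-xor-triangle false true  false = z≤n
bit-xor-triangle false false true  = s≤s z≤n
bit-xor-triangle false false false = z≤n

changes-+-bit-≤ : ∀ f a b → a ≤ b → changes f a + bit (f a xor f b) ≤ changes f b
changes-+-bit-≤ f a zero z≤n rewrite xor-same (f 0) = ≤-refl
changes-+-bit-≤ f a (suc b) a≤1+b with m≤n⇒m<n∨m≡n a≤1+b
... | inj₂ refl rewrite xor-same (f (suc b)) | +-identityʳ (changes f (suc b)) = ≤-refl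
... | inj₁ (s≤s a≤b) = begin
  changes f a + bit (f a xor f (suc b))
    ≤⟨ +-monoʳ-≤ (changes f a) (bit-xor-triangle (f a) (f b) (f (suc b))) ⟩
  changes f a + (bit (f a xor f b) + bit (f b xor f (suc b)))
    ≡⟨ +-assoc (changes f a) _ _ ⟨
  changes f a + bit (f a xor f b) + bit (f b xor f (suc b))
    ≤⟨ +-monoˡ-≤ _ (changes-+-bit-≤ f a b a≤b) ⟩
  changes f b + bit (f b xor f (suc b))
    ≡⟨ changes-suc f b ⟨
  changes f (suc b) ∎
  where open ≤-Reasoning

changes-mono-≤ : ∀ f {a b} → a ≤ b → changes f a ≤ changes f b
changes-mono-≤ f {a} {b} a≤b = ≤-trans (m≤m+n (changes f a) _) (changes-+-bit-≤ f a b a≤b)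

changes-flip : ∀ f {a b} → a ≤ b → f b ≡ not (f a) → suc (changes f a) ≤ changes f b
changes-flip f {a} {b} a≤b fb≡¬fa = subst (_≤ changes f b) count-flip (changes-+-bit-≤ f a b a≤b)
  where
  count-flip : changes f a + bit (f a xor f b) ≡ suc (changes f a)
  count-flip rewrite fb≡¬fa | xor-inverseʳ (f a) = +-comm (changes f a) 1

Alternation : (ℕ → Bool) → ℕ → Set
Alternation f t = ∃[ a ] ∃[ b ] ∃[ c ] ∃[ d ]
  (a < b × b < c × c < d × d ≤ t × f b ≡ not (f a) × f c ≡ f a × f d ≡ f b)

alternation⇒3≤changes : ∀ f t → Alternation f t → 3 ≤ changes f t
alternation⇒3≤changes f t (a , b , c , d , a<b , b<c , c<d , d≤t , fb , fc , fd) =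
  ≤-trans 3≤changes-d (changes-mono-≤ f d≤t)
  where
  fc′ : f c ≡ not (f b)
  fc′ = trans fc (trans (sym (not-involutive (f a))) (cong not (sym fb)))
  fd′ : f d ≡ not (f c)
  fd′ = trans fd (trans fb (cong not (sym fc)))
  3≤changes-d : 3 ≤ changes f d
  3≤changes-d =
    ≤-trans (s≤s (≤-trans (s≤s (≤-trans (s≤s z≤n) (changes-flip f (<⇒≤ a<b) fb)))
                          (changes-flip f (<⇒≤ b<c) fc′)))
            (changes-flip f (<⇒≤ c<d) fd′)

changes-suc-same : ∀ f t → f (suc t) ≡ f t → changes f (suc t) ≡ changes f t
changes-suc-same f t same rewrite changes-suc f t | same | xor-same (f t) = +-identityʳ (changes f t)

changes-suc-flip : ∀ f t → f (suc t) ≡ not (f t) → changes f (suc t) ≡ suc (changes f t)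
changes-suc-flip f t flip rewrite changes-suc f t | flip | xor-inverseʳ (f t) = +-comm (changes f t) 1

same-or-flip : ∀ x y → y ≡ x ⊎ y ≡ not x
same-or-flip true  true  = inj₁ refl
same-or-flip true  false = inj₂ refl
same-or-flip false true  = inj₂ refl
same-or-flip false false = inj₁ refl

data FewChanges (f : ℕ → Bool) (t : ℕ) : Set where
  none : changes f t ≡ 0 → f t ≡ f 0 → FewChanges f t
  one  : changes f t ≡ 1 → f t ≡ not (f 0) → FewChanges f t
  two  : changes f t ≡ 2 → f t ≡ f 0 → ∀ b → b ≤ t → f b ≡ not (f 0) → FewChanges f t

few-changes-or-alternation : ∀ f t → FewChanges f t ⊎ Alternation f t
few-changes-or-alternation f zero    = inj₁ (none refl refl)
few-changes-or-alternation f (suc t) =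
  extend (few-changes-or-alternation f t) (same-or-flip (f t) (f (suc t)))
  where
  extend : FewChanges f t ⊎ Alternation f t → f (suc t) ≡ f t ⊎ f (suc t) ≡ not (f t) →
           FewChanges f (suc t) ⊎ Alternation f (suc t)
  extend (inj₁ (none c e)) (inj₁ s) = inj₁ (none (trans (changes-suc-same f t s) c) (trans s e))
  extend (inj₁ (none c e)) (inj₂ s) = inj₁ (one (trans (changes-suc-flip f t s) (cong suc c)) (trans s (cong not e)))
  extend (inj₁ (one c e))  (inj₁ s) = inj₁ (one (trans (changes-suc-same f t s) c) (trans s e))
  extend (inj₁ (one c e))  (inj₂ s) =
    inj₁ (two (trans (changes-suc-flip f t s) (cong suc c)) (trans s (trans (cong not e) (not-involutive (f 0))))
              t (n≤1+n t) e)
  extend (inj₁ (two c e b b≤t fb)) (inj₁ s) =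
    inj₁ (two (trans (changes-suc-same f t s) c) (trans s e) b (m≤n⇒m≤1+n b≤t) fb)
  extend (inj₁ (two c e b b≤t fb)) (inj₂ s) =
    inj₂ (0 , b , t , suc t , 0<b b fb , b<t , n<1+n t , ≤-refl , fb , e , trans s (trans (cong not e) (sym fb)))
    where
    0<b : ∀ b → f b ≡ not (f 0) → 0 < b
    0<b zero    f0≡¬f0 = ⊥-elim (not-¬ refl f0≡¬f0)
    0<b (suc b) _      = s≤s z≤n
    b<t : b < t
    b<t with m≤n⇒m<n∨m≡n b≤t
    ... | inj₁ b<t  = b<t
    ... | inj₂ refl = ⊥-elim (not-¬ e fb)
  extend (inj₂ (a , b , c , d , a<b , b<c , c<d , d≤t , alt)) _ =
    inj₂ (a , b , c , d , a<b , b<c , c<d , m≤n⇒m≤1+n d≤t , alt)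

¬alternation⇒changes≤2 : ∀ f l → f (suc l) ≡ f 0 → ¬ Alternation f l → changes f (suc l) ≤ 2
¬alternation⇒changes≤2 f l periodic ¬alt with few-changes-or-alternation f l
... | inj₂ alt = ⊥-elim (¬alt alt)
... | inj₁ (none c e)     = ≤-trans (≤-reflexive (trans (changes-suc-same f l (trans periodic (sym e))) c)) z≤n
... | inj₁ (one c e)      = ≤-reflexive (trans (changes-suc-flip f l flip) (cong suc c))
  where
  flip : f (suc l) ≡ not (f l)
  flip = trans periodic (trans (sym (not-involutive (f 0))) (cong not (sym e)))
... | inj₁ (two c e _ _ _) = ≤-reflexive (trans (changes-suc-same f l (trans periodic (sym e))) c)

module _ {n m : ℕ} (G : Graph n m) where

  joins-sym : ∀ {e u v} → Joins G e u v → Joins G e v u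
  joins-sym (inj₁ uv) = inj₂ uv
  joins-sym (inj₂ vu) = inj₁ vu

  joins-unique : ∀ {e a b c d} → Joins G e a b → Joins G e c d → (a ≡ c × b ≡ d) ⊎ (a ≡ d × b ≡ c)
  joins-unique (inj₁ (p , q)) (inj₁ (r , s)) = inj₁ (trans (sym p) r , trans (sym q) s)
  joins-unique (inj₁ (p , q)) (inj₂ (r , s)) = inj₂ (trans (sym p) r , trans (sym q) s)
  joins-unique (inj₂ (p , q)) (inj₁ (r , s)) = inj₂ (trans (sym q) s , trans (sym p) r)
  joins-unique (inj₂ (p , q)) (inj₂ (r , s)) = inj₁ (trans (sym q) s , trans (sym p) r)

  EdgeWithin : (Fin n → Set) → Fin m → Set
  EdgeWithin T e = T (proj₁ (ends G e)) × T (proj₂ (ends G e))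

  joins⇒edgeWithin : ∀ {T e x y} → Joins G e x y → T x → T y → EdgeWithin T e
  joins⇒edgeWithin {T} (inj₁ (p , q)) tx ty = subst T (sym p) tx , subst T (sym q) ty
  joins⇒edgeWithin {T} (inj₂ (p , q)) tx ty = subst T (sym p) ty , subst T (sym q) tx

  edgeWithin⇒ends : ∀ {T e x y} → Joins G e x y → EdgeWithin T e → T x × T y
  edgeWithin⇒ends {T} (inj₁ (p , q)) (a , b) = subst T p a , subst T q b
  edgeWithin⇒ends {T} (inj₂ (p , q)) (a , b) = subst T q b , subst T p a

  ≡false⇒complement : ∀ {S v} → S v ≡ false → complement G S v ≡ true
  ≡false⇒complement Sv≡false rewrite Sv≡false = refl

  complement⇒≡false : ∀ {S v} → complement G S v ≡ true → S v ≡ false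
  complement⇒≡false {S} {v} _ with S v
  complement⇒≡false () | true
  ... | false = refl

  walk-head : ∀ {A u w vs} → Walk G A u w vs → u ∈ vs
  walk-head here           = here refl
  walk-head (step _ _ _ _) = here refl

  walk-last : ∀ {A u w vs} → Walk G A u w vs → w ∈ vs
  walk-last here           = here refl
  walk-last (step _ _ _ r) = there (walk-last r)

  walk-within : ∀ {T u w vs} → Walk G (EdgeWithin T) u w vs → T u → ∀ v → v ∈ vs → T v
  walk-within here           tu v (here refl) = tu
  walk-within (step _ _ _ _) tu v (here refl) = tu
  walk-within (step e a j r) tu v (there v∈) = walk-within r (proj₂ (edgeWithin⇒ends j a)) v v∈

  Reach : (Fin m → Set) → (Fin n → Set) → Fin n → Fin n → Set
  Reach A P u w = ∃[ vs ] (Walk G A u w vs × (∀ v → v ∈ vs → P v))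

  reach-head : ∀ {A P u w} → Reach A P u w → P u
  reach-head (_ , wk , ok) = ok _ (walk-head wk)

  reach-last : ∀ {A P u w} → Reach A P u w → P w
  reach-last (_ , wk , ok) = ok _ (walk-last wk)

  reach-refl : ∀ {A P u} → P u → Reach A P u u
  reach-refl {u = u} pu = u ∷ [] , here , λ { v (here refl) → pu }

  reach-step : ∀ {A P u v w e} → A e → Joins G e u v → P u → Reach A P v w → Reach A P u w
  reach-step {u = u} a j pu (vs , wk , ok) =
    u ∷ vs , step _ a j wk , λ { z (here refl) → pu ; z (there z∈) → ok z z∈ }

  walk-snoc : ∀ {A u v w e vs} → Walk G A u v vs → A e → Joins G e v w → Walk G A u w (vs ++ [ w ])
  walk-snoc here           a j = step _ a j here
  walk-snoc (step e a′ j′ r) a j = step e a′ j′ (walk-snoc r a j)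

  reach-snoc : ∀ {A P u v w e} → Reach A P u v → A e → Joins G e v w → P w → Reach A P u w
  reach-snoc {P = P} {w = w} (vs , wk , ok) a j pw = vs ++ [ w ] , walk-snoc wk a j , λ z z∈ → ok′ z (∈-++⁻ vs z∈)
    where
    ok′ : ∀ z → z ∈ vs ⊎ z ∈ [ w ] → P z
    ok′ z (inj₁ z∈vs)       = ok z z∈vs
    ok′ z (inj₂ (here refl)) = pw

  reach-sym : ∀ {A P u w} → Reach A P u w → Reach A P w u
  reach-sym {A} {P} (_ , wk , ok) = go wk ok
    where
    go : ∀ {u w vs} → Walk G A u w vs → (∀ v → v ∈ vs → P v) → Reach A P w u
    go here           ok = _ , here , ok
    go (step e a j r) ok = reach-snoc (go r (λ v → ok v ∘ there)) a (joins-sym j) (ok _ (here refl))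

  reach-trans : ∀ {A P u v w} → Reach A P u v → Reach A P v w → Reach A P u w
  reach-trans {A} {P} (_ , wk , ok) = go wk ok
    where
    go : ∀ {u v w vs} → Walk G A u v vs → (∀ v → v ∈ vs → P v) → Reach A P v w → Reach A P u w
    go here           ok r′ = r′
    go (step e a j r) ok r′ = reach-step a j (ok _ (here refl)) (go r (λ v → ok v ∘ there) r′)

  reach-map : ∀ {A A′ : Fin m → Set} {P P′ : Fin n → Set} {u w} →
              (∀ {e} → A e → A′ e) → (∀ {v} → P v → P′ v) → Reach A P u w → Reach A′ P′ u w
  reach-map {A} {A′} fa fp (vs , wk , ok) = vs , go wk , λ v → fp ∘ ok v
    where
    go : ∀ {u w vs} → Walk G A u w vs → Walk G A′ u w vs
    go here           = here
    go (step e a j r) = step e (fa a) j (go r)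

  walk-within⇒reach : ∀ {T u w vs} → Walk G (EdgeWithin T) u w vs → T u → Reach (λ _ → ⊤) T u w
  walk-within⇒reach wk tu = reach-map (λ _ → tt) (λ t → t) (_ , wk , walk-within wk tu)

  private
    open DecMembership (_≟ᶠ_ {n}) using (_∈?_)

    SubPath : (Fin m → Set) → Fin n → Fin n → List (Fin n) → Set
    SubPath A u w vs = ∃[ ws ] (Walk G A u w ws × Unique ws × (∀ z → z ∈ ws → z ∈ vs))

    path-suffix : ∀ {A u v w ws} → Walk G A v w ws → Unique ws → u ∈ ws → SubPath A u w ws
    path-suffix here           uq       (here refl) = _ , here , uq , λ _ z∈ → z∈
    path-suffix (step e a j r) uq       (here refl) = _ , step e a j r , uq , λ _ z∈ → z∈
    path-suffix (step e a j r) (_ ∷ uq) (there u∈) with path-suffix r uq u∈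
    ... | ws , wk , uq′ , sub = ws , wk , uq′ , λ z → there ∘ sub z

    walk⇒subPath : ∀ {A u w vs} → Walk G A u w vs → SubPath A u w vs
    walk⇒subPath here = _ , here , [] ∷ [] , λ _ z∈ → z∈
    walk⇒subPath {u = u} (step e a j r) with walk⇒subPath r
    ... | ws , wk , uq , sub with u ∈? ws
    ...   | yes u∈ = let ws′ , wk′ , uq′ , sub′ = path-suffix wk uq u∈
                     in ws′ , wk′ , uq′ , λ z → there ∘ sub z ∘ sub′ z
    ...   | no  u∉ = u ∷ ws , step e a j wk , ¬Any⇒All¬ ws u∉ ∷ uq ,
                     λ { z (here refl) → here refl ; z (there z∈) → there (sub z z∈) }

  reach⇒path : ∀ {A P u w} → Reach A P u w → ∃[ vs ] (Path G A u w vs × (∀ v → v ∈ vs → P v))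
  reach⇒path (vs , wk , ok) with walk⇒subPath wk
  ... | ws , wk′ , uq , sub = ws , (wk′ , uq) , λ v → ok v ∘ sub v

  reach-within : ∀ {A : Fin m → Set} {T Allowed : Fin n → Set} →
                 (∀ {x y e} → A e → T x → Joins G e x y → Allowed y → T y) →
                 ∀ {x w vs} → Walk G A x w vs → T x → (∀ v → v ∈ vs → Allowed v) →
                 Reach (EdgeWithin T) T x w
  reach-within closed here           tx ok = reach-refl tx
  reach-within closed (step e a j r) tx ok =
    reach-step (joins⇒edgeWithin j tx ty) j tx (reach-within closed r ty (λ v → ok v ∘ there))
    where ty = closed a tx j (ok _ (there (walk-head r)))

module _ {l : ℕ} where

  toℕ-csuc : ∀ (i : Fin (suc l)) → toℕ (csuc i) ≡ suc (toℕ i) ⊎ (toℕ (csuc i) ≡ 0 × toℕ i ≡ l)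
  toℕ-csuc i with suc (toℕ i) <? suc l
  ... | yes i+1<L = inj₁ (trans (toℕ-fromℕ< (m%n<n (suc (toℕ i)) (suc l))) (m<n⇒m%n≡m i+1<L))
  ... | no  i+1≮L = inj₂ (trans (toℕ-fromℕ< (m%n<n (suc (toℕ i)) (suc l)))
                                (trans (cong (_% suc l) i+1≡L) (n%n≡0 (suc l))) ,
                          suc-injective i+1≡L)
    where
    i+1≡L : suc (toℕ i) ≡ suc l
    i+1≡L = ≤-antisym (toℕ<n i) (≮⇒≥ i+1≮L)

  Adjacent : Fin (suc l) → Fin (suc l) → Set
  Adjacent i j = j ≡ csuc i ⊎ i ≡ csuc j

  adjacent-sym : ∀ {i j} → Adjacent i j → Adjacent j i
  adjacent-sym (inj₁ e) = inj₂ e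
  adjacent-sym (inj₂ e) = inj₁ e

  Inside : Fin (suc l) → Fin (suc l) → Fin (suc l) → Set
  Inside lo hi i = toℕ lo < toℕ i × toℕ i < toℕ hi

  Outside : Fin (suc l) → Fin (suc l) → Fin (suc l) → Set
  Outside lo hi i = toℕ i < toℕ lo ⊎ toℕ hi < toℕ i

  inside? : ∀ lo hi → Decidable (Inside lo hi)
  inside? lo hi i = toℕ lo <? toℕ i ×-dec toℕ i <? toℕ hi

  outside? : ∀ lo hi → Decidable (Outside lo hi)
  outside? lo hi i = toℕ i <? toℕ lo ⊎-dec toℕ hi <? toℕ i

  inside-outside-disjoint : ∀ lo hi i → Inside lo hi i → ¬ Outside lo hi i
  inside-outside-disjoint lo hi i (lo<i , i<hi) (inj₁ i<lo) = <-asym lo<i i<lo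
  inside-outside-disjoint lo hi i (lo<i , i<hi) (inj₂ hi<i) = <-asym i<hi hi<i

  inside-or-outside : ∀ lo hi i → i ≢ lo → i ≢ hi → Inside lo hi i ⊎ Outside lo hi i
  inside-or-outside lo hi i i≢lo i≢hi with <-cmp (toℕ i) (toℕ lo) | <-cmp (toℕ i) (toℕ hi)
  ... | tri< i<lo _ _ | _             = inj₂ (inj₁ i<lo)
  ... | tri≈ _ i≡lo _ | _             = ⊥-elim (i≢lo (toℕ-injective i≡lo))
  ... | tri> _ _ lo<i | tri< i<hi _ _ = inj₁ (lo<i , i<hi)
  ... | tri> _ _ _    | tri≈ _ i≡hi _ = ⊥-elim (i≢hi (toℕ-injective i≡hi))
  ... | tri> _ _ _    | tri> _ _ hi<i = inj₂ (inj₂ hi<i)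

  inside-outside-nonadjacent : ∀ lo hi i j → Inside lo hi i → Outside lo hi j → ¬ Adjacent i j
  inside-outside-nonadjacent lo hi i j (lo<i , i<hi) out (inj₁ j≡i+) with toℕ-csuc i
  ... | inj₁ i+≡ = successor-not-outside (trans (cong toℕ j≡i+) i+≡) out
    where
    successor-not-outside : ∀ {y} → y ≡ suc (toℕ i) → ¬ (y < toℕ lo ⊎ toℕ hi < y)
    successor-not-outside refl (inj₁ i+1<lo) = <-asym lo<i (<-trans (n<1+n _) i+1<lo)
    successor-not-outside refl (inj₂ hi<i+1) = <⇒≱ i<hi (≤-pred hi<i+1)
  ... | inj₂ (_ , i≡l) = <⇒≱ i<hi (subst (toℕ hi ≤_) (sym i≡l) (≤-pred (toℕ<n hi)))
  inside-outside-nonadjacent lo hi i j (lo<i , i<hi) out (inj₂ i≡j+) with toℕ-csuc j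
  ... | inj₁ j+≡ = predecessor-not-outside (trans (cong toℕ i≡j+) j+≡) out
    where
    predecessor-not-outside : toℕ i ≡ suc (toℕ j) → ¬ (toℕ j < toℕ lo ⊎ toℕ hi < toℕ j)
    predecessor-not-outside i≡j+1 (inj₁ j<lo) = <⇒≱ j<lo (≤-pred (subst (toℕ lo <_) i≡j+1 lo<i))
    predecessor-not-outside i≡j+1 (inj₂ hi<j) = <-asym (<-trans (n<1+n _) (subst (_< toℕ hi) i≡j+1 i<hi)) hi<j
  ... | inj₂ (j+≡0 , _) = <⇒≱ lo<i (subst (_≤ toℕ lo) (sym (trans (cong toℕ i≡j+) j+≡0)) z≤n)

  split-by-outside-inside : ∀ b d p q → Outside b d p → Inside b d q →
    (toℕ p < toℕ q × Inside p q b × Outside p q d) ⊎ (toℕ q < toℕ p × Outside q p b × Inside q p d)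
  split-by-outside-inside b d p q (inj₁ p<b) (b<q , q<d) = inj₁ (<-trans p<b b<q , (p<b , b<q) , inj₂ q<d)
  split-by-outside-inside b d p q (inj₂ d<p) (b<q , q<d) = inj₂ (<-trans q<d d<p , inj₁ b<q , (q<d , d<p))

  record ArcSplit (Q A B : Fin (suc l) → Set) : Set where
    field
      covers      : ∀ i → Q i → A i ⊎ B i
      nonadjacent : ∀ i j → A i → B j → ¬ Adjacent i j
      disjoint    : ∀ i → A i → ¬ B i
      decide-B    : Decidable B

  arcs : ∀ {Q} lo hi → toℕ lo < toℕ hi → ¬ Q lo → ¬ Q hi →
         ArcSplit Q (Inside lo hi) (Outside lo hi) × ArcSplit Q (Outside lo hi) (Inside lo hi)
  arcs {Q} lo hi lo<hi ¬Qlo ¬Qhi =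
    record { covers      = covers
           ; nonadjacent = inside-outside-nonadjacent lo hi
           ; disjoint    = inside-outside-disjoint lo hi
           ; decide-B    = outside? lo hi } ,
    record { covers      = λ i → Data.Sum.swap ∘ covers i
           ; nonadjacent = λ i j out ins → inside-outside-nonadjacent lo hi j i ins out ∘ adjacent-sym
           ; disjoint    = λ i out ins → inside-outside-disjoint lo hi i ins out
           ; decide-B    = inside? lo hi }
    where
    covers : ∀ i → Q i → Inside lo hi i ⊎ Outside lo hi i
    covers i Qi = inside-or-outside lo hi i (λ { refl → ¬Qlo Qi }) (λ { refl → ¬Qhi Qi })

module _ {n m : ℕ} {G : Graph n m} (C : Cycle G) where

  private
    L : ℕ
    L = suc (len-1 C)

  OnCycle : Fin n → Set
  OnCycle v = ∃[ i ] vert C i ≡ v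

  onCycle? : Decidable OnCycle
  onCycle? v = any? (λ i → vert C i ≟ᶠ v)

  joins-offCycle⇒notInCycle : ∀ {e x y} → Joins G e x y → ¬ OnCycle y → NotInCycle C e
  joins-offCycle⇒notInCycle j y∉C (i , refl) with joins-unique G (edgeJ C i) j
  ... | inj₁ (_ , i+≡y) = y∉C (csuc i , i+≡y)
  ... | inj₂ (i≡y , _)  = y∉C (i , i≡y)

  joins-nonadjacent⇒notInCycle : ∀ {e p k} → Joins G e (vert C p) (vert C k) → ¬ Adjacent p k → NotInCycle C e
  joins-nonadjacent⇒notInCycle j ¬adj (i , refl) with joins-unique G (edgeJ C i) j
  ... | inj₁ (i≡p , i+≡k) = ¬adj (inj₁ (trans (sym (vertInj C i+≡k)) (cong csuc (vertInj C i≡p))))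
  ... | inj₂ (i≡k , i+≡p) = ¬adj (inj₂ (trans (sym (vertInj C i+≡p)) (cong csuc (vertInj C i≡k))))

  Chord : (Fin n → Set) → (Fin L → Set) → (Fin L → Set) → Set
  Chord Side A B = ∃[ p ] ∃[ q ] (A p × B q × Reach G (NotInCycle C) Side (vert C p) (vert C q))

  chord : ∀ {Side A B p₀ q₀} → ArcSplit (Side ∘ vert C) A B → A p₀ → B q₀ →
          Reach G (λ _ → ⊤) Side (vert C p₀) (vert C q₀) → Chord Side A B
  chord {Side} {A} {B} {p₀} {q₀} split Ap₀ Bq₀ (_ , wk , ok) =
    go wk refl ok (p₀ , Ap₀ , reach-refl G (ok _ (walk-head G wk)) , inj₁ refl)
    where
    open ArcSplit split

    -- The walk so far has been cut at its last cycle vertex p, which lies in A; the current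
    -- vertex is p itself or off C, so the next edge is a cycle edge only if it leads to a
    -- position adjacent to p.
    CutAtA : Fin n → Set
    CutAtA x = ∃[ p ] (A p × Reach G (NotInCycle C) Side (vert C p) x × (x ≡ vert C p ⊎ ¬ OnCycle x))

    go : ∀ {x w vs} → Walk G (λ _ → ⊤) x w vs → w ≡ vert C q₀ → (∀ v → v ∈ vs → Side v) →
         CutAtA x → Chord Side A B
    go here w≡q₀ _ (p , Ap , _ , inj₁ w≡p) = ⊥-elim (disjoint q₀ (subst A (vertInj C (trans (sym w≡p) w≡q₀)) Ap) Bq₀)
    go here w≡q₀ _ (_ , _  , _ , inj₂ w∉C) = ⊥-elim (w∉C (q₀ , sym w≡q₀))
    go (step {u = x} {v = y} e _ j r) w≡q₀ ok (p , Ap , p⇝x , x-cut) with onCycle? y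
    ... | no y∉C = go r w≡q₀ (λ v → ok v ∘ there)
                     (p , Ap , reach-snoc G p⇝x (joins-offCycle⇒notInCycle j y∉C) j Side-y , inj₂ y∉C)
      where
      Side-y : Side y
      Side-y = ok y (there (walk-head G r))
    ... | yes (k , k≡y) with decide-B k
    ...   | yes Bk = p , k , Ap , Bk ,
                     subst (Reach G (NotInCycle C) Side (vert C p)) (sym k≡y)
                           (reach-snoc G p⇝x (e∉C x-cut) j Side-y)
      where
      Side-y : Side y
      Side-y = ok y (there (walk-head G r))
      e∉C : x ≡ vert C p ⊎ ¬ OnCycle x → NotInCycle C e
      e∉C (inj₁ refl) = joins-nonadjacent⇒notInCycle (subst (Joins G e _) (sym k≡y) j) (nonadjacent p k Ap Bk)
      e∉C (inj₂ x∉C)  = joins-offCycle⇒notInCycle (joins-sym G j) x∉C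
    ...   | no ¬Bk = go r w≡q₀ (λ v → ok v ∘ there) (k , Ak , k⇝y , inj₁ (sym k≡y))
      where
      Side-k : Side (vert C k)
      Side-k = subst Side (sym k≡y) (ok y (there (walk-head G r)))
      Ak : A k
      Ak = Data.Sum.[ (λ a → a) , (λ b → ⊥-elim (¬Bk b)) ] (covers k Side-k)
      k⇝y : Reach G (NotInCycle C) Side (vert C k) y
      k⇝y = subst (Reach G (NotInCycle C) Side (vert C k)) k≡y (reach-refl G Side-k)

  Shore : (Fin n → Bool) → Bool → Fin n → Set
  Shore S β v = S v ≡ β

  shore-reach : ∀ {S} → IsBond G S → ∀ {β u w} → S u ≡ β → S w ≡ β → Reach G (λ _ → ⊤) (Shore S β) u w
  shore-reach (_ , _ , connS , _) {true} {u} {w} Su Sw with connS u w Su Sw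
  ... | _ , wk , _ = walk-within⇒reach G wk Su
  shore-reach {S} (_ , _ , _ , connS̅) {false} {u} {w} Su Sw
    with connS̅ u w (≡false⇒complement G {S} Su) (≡false⇒complement G {S} Sw)
  ... | _ , wk , _ =
    reach-map G (λ t → t) (complement⇒≡false G {S}) (walk-within⇒reach G wk (≡false⇒complement G {S} Su))

  interleaved-by-shores : ∀ {S β₁ β₂} i₁ i₂ i₃ i₄ → β₁ ≢ β₂ →
    toℕ i₁ < toℕ i₂ → toℕ i₂ < toℕ i₃ → toℕ i₃ < toℕ i₄ →
    Reach G (NotInCycle C) (Shore S β₁) (vert C i₁) (vert C i₃) →
    Reach G (NotInCycle C) (Shore S β₂) (vert C i₂) (vert C i₄) → Interleaved C
  interleaved-by-shores i₁ i₂ i₃ i₄ β₁≢β₂ i₁<i₂ i₂<i₃ i₃<i₄ r₁₃ r₂₄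
    with reach⇒path G r₁₃ | reach⇒path G r₂₄
  ... | P , path-P , P⊆β₁ | Q , path-Q , Q⊆β₂ =
    i₁ , i₂ , i₃ , i₄ , i₁<i₂ , i₂<i₃ , i₃<i₄ , P , Q , path-P , path-Q ,
    λ v v∈P v∈Q → β₁≢β₂ (trans (sym (P⊆β₁ v v∈P)) (Q⊆β₂ v v∈Q))

  module _ {S : Fin n → Bool} (bond : IsBond G S) where

    private
      β≢¬β : ∀ {β} → β ≢ not β
      β≢¬β = not-¬ refl

    crossing-paths : ∀ {β lo hi s t} → toℕ lo < toℕ hi →
      Reach G (NotInCycle C) (Shore S β) (vert C lo) (vert C hi) →
      Inside lo hi s → Outside lo hi t → S (vert C s) ≡ not β → S (vert C t) ≡ not β → Interleaved C
    crossing-paths {β} {lo} {hi} lo<hi lo⇝hi s-in t-out Ss St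
      with chord (proj₁ (arcs lo hi lo<hi (not-¬ (reach-head G lo⇝hi)) (not-¬ (reach-last G lo⇝hi))))
                 s-in t-out (shore-reach bond Ss St)
    ... | p , q , (lo<p , p<hi) , inj₁ q<lo , p⇝q =
      interleaved-by-shores q lo p hi (β≢¬β ∘ sym) q<lo lo<p p<hi (reach-sym G p⇝q) lo⇝hi
    ... | p , q , (lo<p , p<hi) , inj₂ hi<q , p⇝q =
      interleaved-by-shores lo p hi q β≢¬β lo<p p<hi hi<q lo⇝hi p⇝q

    alternating⇒interleaved : ∀ {a b c d} → toℕ a < toℕ b → toℕ b < toℕ c → toℕ c < toℕ d →
      S (vert C b) ≡ not (S (vert C a)) → S (vert C c) ≡ S (vert C a) → S (vert C d) ≡ S (vert C b) →
      Interleaved C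
    alternating⇒interleaved {a} {b} {c} {d} a<b b<c c<d Sb Sc Sd
      with chord (proj₂ (arcs b d (<-trans b<c c<d) (λ Qb → not-¬ Qb Sb) (λ Qd → not-¬ Qd (trans Sd Sb))))
                 (inj₁ a<b) (b<c , c<d) (shore-reach bond refl Sc)
    ... | p , q , p-out , q-in , p⇝q with split-by-outside-inside b d p q p-out q-in
    ...   | inj₁ (p<q , b-in , d-out) = crossing-paths p<q p⇝q b-in d-out Sb (trans Sd Sb)
    ...   | inj₂ (q<p , b-out , d-in) = crossing-paths q<p (reach-sym G p⇝q) d-in b-out (trans Sd Sb) Sb

  cyclic : (Fin n → Bool) → ℕ → Bool
  cyclic S k = S (vert C (fromℕ< (m%n<n k L)))

  cyclic-toℕ : ∀ S j → cyclic S (toℕ j) ≡ S (vert C j)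
  cyclic-toℕ S j =
    cong (S ∘ vert C) (toℕ-injective (trans (toℕ-fromℕ< (m%n<n (toℕ j) L)) (m<n⇒m%n≡m (toℕ<n j))))

  cyclic-periodic : ∀ S → cyclic S L ≡ cyclic S 0
  cyclic-periodic S =
    cong (S ∘ vert C)
         (toℕ-injective (trans (toℕ-fromℕ< (m%n<n L L)) (trans (n%n≡0 L) (sym (toℕ-fromℕ< (m%n<n 0 L))))))

  cycle-cut-sum : ∀ S → sumℚ L (λ j → cutVector G S (edge C j)) ≡ fromℕ (changes (cyclic S) L)
  cycle-cut-sum S = trans (sumℚ-cong L cut-on-edge) (sumℚ-bitℚ L (λ i → cyclic S i xor cyclic S (suc i)))
    where
    -- cyclic S (suc (toℕ j)) reduces to S (vert C (csuc j)): csuc is also computed mod L.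
    cut-on-edge : ∀ j → cutVector G S (edge C j) ≡ bitℚ (cyclic S (toℕ j) xor cyclic S (suc (toℕ j)))
    cut-on-edge j with edgeJ C j
    ... | inj₁ (p , q) rewrite p | q | cyclic-toℕ S j = refl
    ... | inj₂ (p , q) rewrite p | q | cyclic-toℕ S j =
      cong bitℚ (xor-comm (S (vert C (csuc j))) (S (vert C j)))

  nonInterleaved⇒bond-changes≤2 : NonInterleaved C → ∀ {S} → IsBond G S → changes (cyclic S) L ≤ 2
  nonInterleaved⇒bond-changes≤2 ¬int {S} bond =
    ¬alternation⇒changes≤2 (cyclic S) (len-1 C) (cyclic-periodic S) (¬int ∘ alternation⇒interleaved)
    where
    position : ∀ {k} → k ≤ len-1 C → Fin L
    position k≤l = fromℕ< (s≤s k≤l)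

    cyclic-position : ∀ {k} (k≤l : k ≤ len-1 C) → cyclic S k ≡ S (vert C (position k≤l))
    cyclic-position {k} k≤l = trans (cong (cyclic S) (sym (toℕ-fromℕ< (s≤s k≤l)))) (cyclic-toℕ S _)

    position-< : ∀ {j k} (j≤l : j ≤ len-1 C) (k≤l : k ≤ len-1 C) → j < k →
                 toℕ (position j≤l) < toℕ (position k≤l)
    position-< j≤l k≤l j<k rewrite toℕ-fromℕ< (s≤s j≤l) | toℕ-fromℕ< (s≤s k≤l) = j<k

    alternation⇒interleaved : Alternation (cyclic S) (len-1 C) → Interleaved C
    alternation⇒interleaved (a , b , c , d , a<b , b<c , c<d , d≤l , fb , fc , fd) =
      alternating⇒interleaved bond
        (position-< a≤l b≤l a<b) (position-< b≤l c≤l b<c) (position-< c≤l d≤l c<d)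
        (trans (sym (cyclic-position b≤l)) (trans fb (cong not (cyclic-position a≤l))))
        (trans (sym (cyclic-position c≤l)) (trans fc (cyclic-position a≤l)))
        (trans (sym (cyclic-position d≤l)) (trans fd (cyclic-position b≤l)))
      where
      c≤l = ≤-trans (<⇒≤ c<d) d≤l
      b≤l = ≤-trans (<⇒≤ b<c) c≤l
      a≤l = ≤-trans (<⇒≤ a<b) b≤l

  nonInterleaved⇒valid : NonInterleaved C → CycleIneqValid C
  nonInterleaved⇒valid ¬int = bondPolytope-sum-≤ G (edge C) λ S bond →
    subst (ℚ._≤ 2ℚ) (sym (cycle-cut-sum S)) (fromℕ-mono-≤ (nonInterleaved⇒bond-changes≤2 ¬int bond))

¬¬-decidable : ∀ {k} (P : Fin k → Set) → ¬ ¬ Decidable P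
¬¬-decidable {zero}  P ¬dec = ¬dec (λ ())
¬¬-decidable {suc k} P ¬dec = ¬¬-excluded-middle λ P0? → ¬¬-decidable (P ∘ Fin.suc) λ Ps? →
  ¬dec λ { Fin.zero → P0? ; (Fin.suc i) → Ps? i }

Separates : ∀ {n} → (Fin n → Bool) → Fin n → Fin n → Fin n → Fin n → Set
Separates S v₁ v₂ v₃ v₄ = S v₁ ≡ true × S v₂ ≡ false × S v₃ ≡ true × S v₄ ≡ false

module _ {n m : ℕ} (G : Graph n m) (connected : Connected G) where

  private
    module Separation {A B : Fin m → Set} {v₁ v₂ v₃ v₄ : Fin n} {P Q : List (Fin n)}
                      (wP : Walk G A v₁ v₃ P) (wQ : Walk G B v₂ v₄ Q) (P∩Q=∅ : ∀ v → v ∈ P → ¬ v ∈ Q) where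

      R₁ : Fin n → Set
      R₁ = Reach G (λ _ → ⊤) (λ z → ¬ z ∈ Q) v₁

      R₂ : Fin n → Set
      R₂ = Reach G (λ _ → ⊤) (λ z → ¬ R₁ z) v₂

      R₁v₁ : R₁ v₁
      R₁v₁ = reach-refl G (P∩Q=∅ v₁ (walk-head G wP))

      R₁v₃ : R₁ v₃
      R₁v₃ = reach-map G (λ _ → tt) (λ z∉Q → z∉Q) (P , wP , P∩Q=∅)

      R₁⇒¬R₂ : ∀ {z} → R₁ z → ¬ R₂ z
      R₁⇒¬R₂ r₁ r₂ = reach-last G r₂ r₁

      R₂v₂ : R₂ v₂
      R₂v₂ = reach-refl G (λ r₁ → reach-last G r₁ (walk-head G wQ))

      R₂v₄ : R₂ v₄
      R₂v₄ = reach-map G (λ _ → tt) (λ z → z) (Q , wQ , λ v v∈Q r₁ → reach-last G r₁ v∈Q)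

      module _ (R₁? : Decidable R₁) (R₂? : Decidable R₂) where

        S : Fin n → Bool
        S v = not (does (R₂? v))

        InS̅ : Fin n → Set
        InS̅ = InS G (complement G S)

        ¬R₂⇒S : ∀ {v} → ¬ R₂ v → S v ≡ true
        ¬R₂⇒S {v} ¬r with R₂? v
        ... | yes r = ⊥-elim (¬r r)
        ... | no  _ = refl

        S⇒¬R₂ : ∀ {v} → S v ≡ true → ¬ R₂ v
        S⇒¬R₂ {v} Sv r with R₂? v
        ... | no ¬r = ¬r r

        R₂⇒S̅ : ∀ {v} → R₂ v → InS̅ v
        R₂⇒S̅ {v} r with R₂? v
        ... | yes _ = refl
        ... | no ¬r = ⊥-elim (¬r r)

        S̅⇒R₂ : ∀ {v} → InS̅ v → R₂ v
        S̅⇒R₂ {v} S̅v with R₂? v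
        ... | yes r = r

        R₁⇒S : ∀ {z} → R₁ z → InS G S z
        R₁⇒S = ¬R₂⇒S ∘ R₁⇒¬R₂

        v₁⇝R₁ : ∀ {z} → R₁ z → Reach G (EdgeWithin G (InS G S)) (InS G S) v₁ z
        v₁⇝R₁ (_ , wk , ok) =
          reach-map G (λ (a , b) → R₁⇒S a , R₁⇒S b) R₁⇒S
            (reach-within G (λ _ r₁x j y∉Q → reach-snoc G r₁x tt j y∉Q) wk R₁v₁ ok)

        -- Follow any walk to v₁ until it enters R₁; before that it stays in S, because a
        -- neighbour in R₂ of a vertex x ∉ R₁ would put x in R₂ as well.
        toward-v₁ : ∀ {x vs} → Walk G (λ _ → ⊤) x v₁ vs → InS G S x → ¬ R₁ x →
                    Reach G (EdgeWithin G (InS G S)) (InS G S) x v₁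
        toward-v₁ here                    _  ¬R₁x = ⊥-elim (¬R₁x R₁v₁)
        toward-v₁ (step {v = y} e _ j r) Sx ¬R₁x with R₁? y
        ... | yes R₁y = reach-step G (joins⇒edgeWithin G j Sx (R₁⇒S R₁y)) j Sx (reach-sym G (v₁⇝R₁ R₁y))
        ... | no ¬R₁y = reach-step G (joins⇒edgeWithin G j Sx Sy) j Sx (toward-v₁ r Sy ¬R₁y)
          where
          Sy : InS G S y
          Sy = ¬R₂⇒S (λ R₂y → S⇒¬R₂ Sx (reach-snoc G R₂y tt (joins-sym G j) ¬R₁x))

        S⇝v₁ : ∀ u → InS G S u → Reach G (EdgeWithin G (InS G S)) (InS G S) u v₁
        S⇝v₁ u Su with R₁? u
        ... | yes R₁u = reach-sym G (v₁⇝R₁ R₁u)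
        ... | no ¬R₁u = toward-v₁ (proj₁ (proj₂ (connected u v₁))) Su ¬R₁u

        v₂⇝S̅ : ∀ {u} → R₂ u → Reach G (EdgeWithin G InS̅) InS̅ v₂ u
        v₂⇝S̅ (_ , wk , ok) =
          reach-within G (λ _ S̅x j ¬R₁y → R₂⇒S̅ (reach-snoc G (S̅⇒R₂ S̅x) tt j ¬R₁y)) wk (R₂⇒S̅ R₂v₂) ok

        induced-path : ∀ {T u w} → Reach G (EdgeWithin G T) T u w → ∃[ vs ] Path G (EdgeWithin G T) u w vs
        induced-path r with reach⇒path G r
        ... | vs , path , _ = vs , path

        bond : IsBond G S
        bond = (v₁ , R₁⇒S R₁v₁) , (v₂ , R₂⇒S̅ R₂v₂) ,
               (λ u w Su Sw → induced-path (reach-trans G (S⇝v₁ u Su) (reach-sym G (S⇝v₁ w Sw)))) ,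
               (λ u w S̅u S̅w →
                  induced-path (reach-trans G (reach-sym G (v₂⇝S̅ (S̅⇒R₂ S̅u))) (v₂⇝S̅ (S̅⇒R₂ S̅w))))

        separates : Separates S v₁ v₂ v₃ v₄
        separates = R₁⇒S R₁v₁ , complement⇒≡false G {S} (R₂⇒S̅ R₂v₂) ,
                    R₁⇒S R₁v₃ , complement⇒≡false G {S} (R₂⇒S̅ R₂v₄)

  -- Reachability is decidable in a finite graph, but as the bond is only used to derive a
  -- contradiction, decidability under double negation suffices.
  separating-bond : ∀ {A B : Fin m → Set} {v₁ v₂ v₃ v₄ P Q} →
    Walk G A v₁ v₃ P → Walk G B v₂ v₄ Q → (∀ v → v ∈ P → ¬ v ∈ Q) →
    ¬ ¬ (∃[ S ] (IsBond G S × Separates S v₁ v₂ v₃ v₄))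
  separating-bond wP wQ P∩Q=∅ ¬bond =
    ¬¬-decidable R₁ λ R₁? → ¬¬-decidable R₂ λ R₂? → ¬bond (S R₁? R₂? , bond R₁? R₂? , separates R₁? R₂?)
    where open Separation wP wQ P∩Q=∅

module _ {n m : ℕ} {G : Graph n m} (C : Cycle G) where

  private
    L : ℕ
    L = suc (len-1 C)

  valid⇒bond-changes≤2 : CycleIneqValid C → ∀ {S} → IsBond G S → changes (cyclic C S) L ≤ 2
  valid⇒bond-changes≤2 valid {S} bond =
    fromℕ≤2ℚ⇒≤2 _ (subst (ℚ._≤ 2ℚ) (cycle-cut-sum C S) (valid (cutVector G S) (cutVector∈bondPolytope G bond)))

  separated-positions⇒3≤changes : ∀ {S i₁ i₂ i₃ i₄} →
    toℕ i₁ < toℕ i₂ → toℕ i₂ < toℕ i₃ → toℕ i₃ < toℕ i₄ →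
    Separates S (vert C i₁) (vert C i₂) (vert C i₃) (vert C i₄) → 3 ≤ changes (cyclic C S) L
  separated-positions⇒3≤changes {S} {i₁} {i₂} {i₃} {i₄} i₁<i₂ i₂<i₃ i₃<i₄ (S₁ , S₂ , S₃ , S₄) =
    alternation⇒3≤changes (cyclic C S) L
      (toℕ i₁ , toℕ i₂ , toℕ i₃ , toℕ i₄ , i₁<i₂ , i₂<i₃ , i₃<i₄ , <⇒≤ (toℕ<n i₄) ,
       at not i₂ i₁ (trans S₂ (cong not (sym S₁))) ,
       at id i₃ i₁ (trans S₃ (sym S₁)) ,
       at id i₄ i₂ (trans S₄ (sym S₂)))
    where
    at : ∀ (g : Bool → Bool) (j k : Fin L) →
         S (vert C j) ≡ g (S (vert C k)) → cyclic C S (toℕ j) ≡ g (cyclic C S (toℕ k))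
    at g j k eq = trans (cyclic-toℕ C S j) (trans eq (cong g (sym (cyclic-toℕ C S k))))

  interleaved⇒¬valid : Connected G → Interleaved C → ¬ CycleIneqValid C
  interleaved⇒¬valid connected
    (i₁ , i₂ , i₃ , i₄ , i₁<i₂ , i₂<i₃ , i₃<i₄ , P , Q , (wP , _) , (wQ , _) , P∩Q=∅) valid =
    separating-bond G connected wP wQ P∩Q=∅ λ (S , bond , separates) →
      <⇒≱ (separated-positions⇒3≤changes {S} i₁<i₂ i₂<i₃ i₃<i₄ separates) (valid⇒bond-changes≤2 valid bond)

lemma6p2 : ∀ {n m : ℕ} (G : Graph n m) → Connected G → (C : Cycle G) →
             CycleIneqValid C ⇔ NonInterleaved C
lemma6p2 G connected C = mk⇔ (λ valid int → interleaved⇒¬valid C connected int valid)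
                             (nonInterleaved⇒valid C)
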